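{- Let $\mathcal{B}$ be a preorder on $SC$. Then $\rho\models_{\mathcal{B}}\overline{\rho}$ for every message-closed $\rho\in SC$.
   Context: Fix a set $BT$ of base types with a preorder $\le_:$ and a countable set of labels. Contract terms: $\sigma ::= \mathbf{1} \mid ?t.\sigma \mid !t.\sigma \mid ?(\sigma').\sigma \mid !(\sigma').\sigma \mid \sum_{i\in I} ?l_i.\sigma_i \mid \bigoplus_{i\in I} !l_i.\sigma_i \mid \mu x.\sigma \mid x$ ($t\in BT$, $I$ finite nonempty, labels pairwise distinct; $!l.\sigma$ is the one-summand internal sum). A term is guarded if for every subterm $\mu x.\sigma$, every occurrence of $x$ in $\sigma$ lies under a constructor other than $\mu$; $SC$ is the set of closed guarded terms. Transitions: $\mathbf{1}\xrightarrow{\mathsf{ok}}$; $\lambda.\sigma\xrightarrow{\lambda}\sigma$ for prefixes $\lambda\in\{?l,!l,?t,!t,?(\sigma'),!(\sigma')\}$; $\sum_{i\in I}?l_i.\sigma_i\xrightarrow{?l_k}\sigma_k$; $\bigoplus_{i\in I}!l_i.\sigma_i\xrightarrow{\tau}!l_k.\sigma_k$ when $|I|>1$; $\mu x.\sigma\xrightarrow{\tau}\sigma\{\mu x.\sigma/x\}$; nothing else. $\lambda_1\bowtie_{\mathcal{B}}\lambda_2$ iff $(\lambda_1,\lambda_2)$ is $(!l,?l)$, $(?l,!l)$, $(!t_1,?t_2)$ with $t_1\le_:t_2$, $(?t_1,!t_2)$ with $t_2\le_:t_1$, $(!(\sigma_1),?(\sigma_2))$ with $\sigma_1\mathcal{B}\sigma_2$,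 or $(?(\sigma_1),!(\sigma_2))$ with $\sigma_2\mathcal{B}\sigma_1$. $\rho\mid\sigma\xrightarrow{\tau}_{\mathcal{B}}\rho'\mid\sigma'$ iff $\rho\xrightarrow{\tau}\rho'$, $\sigma'=\sigma$; or $\sigma\xrightarrow{\tau}\sigma'$, $\rho'=\rho$; or $\rho\xrightarrow{\lambda_1}\rho'$, $\sigma\xrightarrow{\lambda_2}\sigma'$, $\lambda_1\bowtie_{\mathcal{B}}\lambda_2$. $\models_{\mathcal{B}}$ is the largest relation $R$ on $SC$ such that whenever $\rho R\sigma$: (i) if $\rho\mid\sigma$ has no $\tau$-transition w.r.t. $\mathcal{B}$ then $\rho\xrightarrow{\mathsf{ok}}$, $\sigma\xrightarrow{\mathsf{ok}}$; (ii) $\rho\mid\sigma\xrightarrow{\tau}_{\mathcal{B}}\rho'\mid\sigma'$ implies $\rho'R\sigma'$. The standard dual: $\overline{\mathbf{1}}=\mathbf{1}$, $\overline{x}=x$, $\overline{\mu x.\sigma}=\mu x.\overline{\sigma}$, $\overline{?t.\sigma}=!t.\overline{\sigma}$, $\overline{!t.\sigma}=?t.\overline{\sigma}$, $\overline{?(\sigma^m).\sigma}=!(\sigma^m).\overline{\sigma}$, $\overline{!(\sigma^m).\sigma}=?(\sigma^m).\overline{\sigma}$ (messages unchanged), $\overline{\sum_{i\in I}?l_i.\sigma_i}=\bigoplus_{i\in I}!l_i.\overline{\sigma_i}$, $\overline{\bigoplus_{i\in I}!l_i.\sigma_i}=\sum_{i\in I}?l_i.\overline{\sigma_i}$. A term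 is message-closed (m-closed) if: $\mathbf{1}$ and $x$ are m-closed; $\mu x.\sigma'$ is m-closed if $\sigma'$ is; $!(\sigma^m).\sigma'$ and $?(\sigma^m).\sigma'$ are m-closed if $\sigma'$ is m-closed and $\sigma^m$ is closed; $?t.\sigma'$, $!t.\sigma'$ are m-closed if $\sigma'$ is; $\sum_i?l_i.\sigma_i$ and $\bigoplus_i!l_i.\sigma_i$ are m-closed if all $\sigma_i$ are. -}

module Defs where

open import Data.Nat using (ℕ; _≟_)
open import Data.Product using (Σ; ∃; ∃₂; _×_; _,_)
open import Data.List using (List; []; _∷_)
open import Data.List.Relation.Unary.Unique.Propositional using (Unique)
open import Relation.Binary.PropositionalEquality using (_≡_; _≢_)
open import Relation.Binary.Construct.Closure.ReflexiveTransitive using (Star)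
open import Relation.Nullary using (¬_; yes; no)

Label : Set
Label = ℕ

Var : Set
Var = ℕ

data Contract (BT : Set) : Set
data Branches (BT : Set) : Set

data Contract BT where
  𝟏     : Contract BT
  inT   : BT → Contract BT → Contract BT
  outT  : BT → Contract BT → Contract BT
  inM   : Contract BT → Contract BT → Contract BT
  outM  : Contract BT → Contract BT → Contract BT
  ext   : Branches BT → Contract BT
  int   : Branches BT → Contract BT
  μ     : Var → Contract BT → Contract BT
  var   : Var → Contract BT

data Branches BT where
  [_↦_]   : Label → Contract BT → Branches BT
  _↦_∷_   : Label → Contract BT → Branches BT → Branches BT

module _ {BT : Set} where

  labels : Branches BT → List Label
  labels [ l ↦ _ ] = l ∷ []
  labels (l ↦ _ ∷ bs) = l ∷ labels bs

  data _↦_∈_ : Label → Contract BT → Branches BT → Set where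
    here₁ : ∀ {l σ} → l ↦ σ ∈ [ l ↦ σ ]
    here  : ∀ {l σ bs} → l ↦ σ ∈ (l ↦ σ ∷ bs)
    there : ∀ {l σ l' σ' bs} → l ↦ σ ∈ bs → l ↦ σ ∈ (l' ↦ σ' ∷ bs)

  data _◃_ : Contract BT → Contract BT → Set where
    s-inT   : ∀ {t σ} → σ ◃ inT t σ
    s-outT  : ∀ {t σ} → σ ◃ outT t σ
    s-inM₁  : ∀ {m σ} → m ◃ inM m σ
    s-inM₂  : ∀ {m σ} → σ ◃ inM m σ
    s-outM₁ : ∀ {m σ} → m ◃ outM m σ
    s-outM₂ : ∀ {m σ} → σ ◃ outM m σ
    s-ext   : ∀ {l σ bs} → l ↦ σ ∈ bs → σ ◃ ext bs
    s-int   : ∀ {l σ bs} → l ↦ σ ∈ bs → σ ◃ int bs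
    s-μ     : ∀ {x σ} → σ ◃ μ x σ

  Subterm : Contract BT → Contract BT → Set
  Subterm = Star _◃_

  data FreeIn (x : Var) : Contract BT → Set where
    f-var   : FreeIn x (var x)
    f-μ     : ∀ {y σ} → y ≢ x → FreeIn x σ → FreeIn x (μ y σ)
    f-inT   : ∀ {t σ} → FreeIn x σ → FreeIn x (inT t σ)
    f-outT  : ∀ {t σ} → FreeIn x σ → FreeIn x (outT t σ)
    f-inM₁  : ∀ {m σ} → FreeIn x m → FreeIn x (inM m σ)
    f-inM₂  : ∀ {m σ} → FreeIn x σ → FreeIn x (inM m σ)
    f-outM₁ : ∀ {m σ} → FreeIn x m → FreeIn x (outM m σ)
    f-outM₂ : ∀ {m σ} → FreeIn x σ → FreeIn x (outM m σ)
    f-ext   : ∀ {l σ bs} → l ↦ σ ∈ bs → FreeIn x σ → FreeIn x (ext bs)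
    f-int   : ∀ {l σ bs} → l ↦ σ ∈ bs → FreeIn x σ → FreeIn x (int bs)

  Closed : Contract BT → Set
  Closed σ = ∀ x → ¬ FreeIn x σ

  -- guardedness: in μx.σ, no occurrence of x (bound by this μ) is
  -- reachable from σ through μ-constructors only
  data Unguarded (x : Var) : Contract BT → Set where
    ug-var : Unguarded x (var x)
    ug-μ   : ∀ {y σ} → y ≢ x → Unguarded x σ → Unguarded x (μ y σ)

  Guarded : Contract BT → Set
  Guarded σ = ∀ {x σ'} → Subterm (μ x σ') σ → ¬ Unguarded x σ'

  DistinctLabels : Contract BT → Set
  DistinctLabels σ =
    (∀ {bs} → Subterm (ext bs) σ → Unique (labels bs)) ×
    (∀ {bs} → Subterm (int bs) σ → Unique (labels bs))

  IsSC : Contract BT → Set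
  IsSC σ = DistinctLabels σ × Guarded σ × Closed σ

  -- substitution σ{ρ/x}  (only ever used with ρ closed, so no capture)
  infix 8 _[_/_]
  _[_/_]  : Contract BT → Contract BT → Var → Contract BT
  _[_/_]B : Branches BT → Contract BT → Var → Branches BT
  𝟏 [ ρ / x ] = 𝟏
  inT t σ [ ρ / x ] = inT t (σ [ ρ / x ])
  outT t σ [ ρ / x ] = outT t (σ [ ρ / x ])
  inM m σ [ ρ / x ] = inM (m [ ρ / x ]) (σ [ ρ / x ])
  outM m σ [ ρ / x ] = outM (m [ ρ / x ]) (σ [ ρ / x ])
  ext bs [ ρ / x ] = ext (bs [ ρ / x ]B)
  int bs [ ρ / x ] = int (bs [ ρ / x ]B)
  μ y σ [ ρ / x ] with y ≟ x
  ... | yes _ = μ y σ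
  ... | no _  = μ y (σ [ ρ / x ])
  var y [ ρ / x ] with y ≟ x
  ... | yes _ = ρ
  ... | no _  = var y
  [ l ↦ σ ] [ ρ / x ]B = [ l ↦ σ [ ρ / x ] ]
  (l ↦ σ ∷ bs) [ ρ / x ]B = l ↦ σ [ ρ / x ] ∷ (bs [ ρ / x ]B)

  -- actions (other than ok) and the LTS
  data Act : Set where
    τ    : Act
    ?l !l : Label → Act
    ?t !t : BT → Act
    ?m !m : Contract BT → Act

  data HasOk : Contract BT → Set where
    ok𝟏 : HasOk 𝟏

  data _—[_]→_ : Contract BT → Act → Contract BT → Set where
    st-inT  : ∀ {t σ} → inT t σ —[ ?t t ]→ σ
    st-outT : ∀ {t σ} → outT t σ —[ !t t ]→ σ
    st-inM  : ∀ {m σ} → inM m σ —[ ?m m ]→ σ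
    st-outM : ∀ {m σ} → outM m σ —[ !m m ]→ σ
    st-ext  : ∀ {l σ bs} → l ↦ σ ∈ bs → ext bs —[ ?l l ]→ σ
    st-out  : ∀ {l σ} → int [ l ↦ σ ] —[ !l l ]→ σ          -- !l.σ
    st-int  : ∀ {l σ l' σ' bs} → l ↦ σ ∈ (l' ↦ σ' ∷ bs) →
              int (l' ↦ σ' ∷ bs) —[ τ ]→ int [ l ↦ σ ]
    st-μ    : ∀ {x σ} → μ x σ —[ τ ]→ (σ [ μ x σ / x ])

  module _ (_≤:_ : BT → BT → Set) (B : Contract BT → Contract BT → Set) where

    data _⋈_ : Act → Act → Set where
      ⋈-!? : ∀ {l} → !l l ⋈ ?l l
      ⋈-?! : ∀ {l} → ?l l ⋈ !l l
      ⋈-!?t : ∀ {t₁ t₂} → t₁ ≤: t₂ → !t t₁ ⋈ ?t t₂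
      ⋈-?!t : ∀ {t₁ t₂} → t₂ ≤: t₁ → ?t t₁ ⋈ !t t₂
      ⋈-!?m : ∀ {σ₁ σ₂} → B σ₁ σ₂ → !m σ₁ ⋈ ?m σ₂
      ⋈-?!m : ∀ {σ₁ σ₂} → B σ₂ σ₁ → ?m σ₁ ⋈ !m σ₂

    data PStep : Contract BT → Contract BT → Contract BT → Contract BT → Set where
      left  : ∀ {ρ σ ρ'} → ρ —[ τ ]→ ρ' → PStep ρ σ ρ' σ
      right : ∀ {ρ σ σ'} → σ —[ τ ]→ σ' → PStep ρ σ ρ σ'
      sync  : ∀ {ρ σ ρ' σ' a₁ a₂} → ρ —[ a₁ ]→ ρ' → σ —[ a₂ ]→ σ' →
              a₁ ⋈ a₂ → PStep ρ σ ρ' σ'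

    IsComplianceRel : (Contract BT → Contract BT → Set) → Set
    IsComplianceRel R =
      (∀ {ρ σ} → R ρ σ → IsSC ρ × IsSC σ) ×
      (∀ {ρ σ} → R ρ σ → ¬ (∃₂ λ ρ' σ' → PStep ρ σ ρ' σ') → HasOk ρ × HasOk σ) ×
      (∀ {ρ σ ρ' σ'} → R ρ σ → PStep ρ σ ρ' σ' → R ρ' σ')

    -- ⊨_B : the largest such relation (union of all of them)
    _⊨_ : Contract BT → Contract BT → Set₁
    ρ ⊨ σ = Σ (Contract BT → Contract BT → Set) λ R → IsComplianceRel R × R ρ σ

  IsPreorderOnSC : (Contract BT → Contract BT → Set) → Set
  IsPreorderOnSC B =
    (∀ {σ₁ σ₂} → B σ₁ σ₂ → IsSC σ₁ × IsSC σ₂) ×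
    (∀ {σ} → IsSC σ → B σ σ) ×
    (∀ {σ₁ σ₂ σ₃} → B σ₁ σ₂ → B σ₂ σ₃ → B σ₁ σ₃)

  dual  : Contract BT → Contract BT
  dualB : Branches BT → Branches BT
  dual 𝟏 = 𝟏
  dual (var x) = var x
  dual (μ x σ) = μ x (dual σ)
  dual (inT t σ) = outT t (dual σ)
  dual (outT t σ) = inT t (dual σ)
  dual (inM m σ) = outM m (dual σ)
  dual (outM m σ) = inM m (dual σ)
  dual (ext bs) = int (dualB bs)
  dual (int bs) = ext (dualB bs)
  dualB [ l ↦ σ ] = [ l ↦ dual σ ]
  dualB (l ↦ σ ∷ bs) = l ↦ dual σ ∷ dualB bs

  data MClosed : Contract BT → Set
  data MClosedB : Branches BT → Set
  data MClosed where
    mc-𝟏    : MClosed 𝟏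
    mc-var  : ∀ {x} → MClosed (var x)
    mc-μ    : ∀ {x σ} → MClosed σ → MClosed (μ x σ)
    mc-outM : ∀ {m σ} → Closed m → MClosed σ → MClosed (outM m σ)
    mc-inM  : ∀ {m σ} → Closed m → MClosed σ → MClosed (inM m σ)
    mc-inT  : ∀ {t σ} → MClosed σ → MClosed (inT t σ)
    mc-outT : ∀ {t σ} → MClosed σ → MClosed (outT t σ)
    mc-ext  : ∀ {bs} → MClosedB bs → MClosed (ext bs)
    mc-int  : ∀ {bs} → MClosedB bs → MClosed (int bs)
  data MClosedB where
    mcb-[] : ∀ {l σ} → MClosed σ → MClosedB [ l ↦ σ ]
    mcb-∷  : ∀ {l σ bs} → MClosed σ → MClosedB bs → MClosedB (l ↦ σ ∷ bs)

-- Every τ-derivative of ρ ∣ dual ρ has the form ρ' ∣ σ', where ρ' and σ' are obtained from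
-- unfoldings of some m-closed ρ₀ and of dual ρ₀ (unfolding commutes with dual because messages
-- are closed), possibly followed by the resolution of one internal choice.  Unfolding is
-- deterministic, so once both sides stop at a non-μ head they are dual to each other and can
-- synchronise: labels, base types (by reflexivity of ≤:) and messages (by reflexivity of B on
-- SC) match, and distinct labels force the partner's branch to be the dual of the chosen one.
-- The only stuck dual pair is 𝟏 ∣ 𝟏.
module Submission where

open import Defs
open import Relation.Binary.PropositionalEquality using (_≡_)
open import Relation.Binary.Structures using (IsPreorder)

open import Data.Nat using (_≟_)
open import Data.Product using (∃; ∃₂; _×_; _,_; proj₁; proj₂)
import Data.Product as Prod
open import Data.Sum using (_⊎_; inj₁; inj₂)
import Data.Sum as Sum
open import Data.Empty using (⊥; ⊥-elim)
open import Data.Unit using (⊤; tt)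
open import Data.List using (_∷_)
open import Data.List.Relation.Unary.All using (All; []; _∷_)
open import Data.List.Relation.Unary.AllPairs using ([]; _∷_)
open import Data.List.Relation.Unary.Unique.Propositional using (Unique)
open import Function using (_∘_)
open import Relation.Binary.PropositionalEquality using (refl; sym; trans; cong; cong₂; subst; _≢_)
open import Relation.Binary.Construct.Closure.ReflexiveTransitive using (Star; ε; _◅_; _◅◅_)
open import Relation.Nullary using (¬_; yes; no)

module _ {BT : Set} where
  private
    Ct = Contract BT
    Bs = Branches BT

  subst-fresh : ∀ {x} (σ : Ct) ρ → ¬ FreeIn x σ → σ [ ρ / x ] ≡ σ
  substB-fresh : ∀ {x} (bs : Bs) ρ → (∀ {l σ} → l ↦ σ ∈ bs → ¬ FreeIn x σ) → bs [ ρ / x ]B ≡ bs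
  subst-fresh 𝟏 ρ nf = refl
  subst-fresh (inT t σ) ρ nf = cong (inT t) (subst-fresh σ ρ (nf ∘ f-inT))
  subst-fresh (outT t σ) ρ nf = cong (outT t) (subst-fresh σ ρ (nf ∘ f-outT))
  subst-fresh (inM m σ) ρ nf = cong₂ inM (subst-fresh m ρ (nf ∘ f-inM₁)) (subst-fresh σ ρ (nf ∘ f-inM₂))
  subst-fresh (outM m σ) ρ nf = cong₂ outM (subst-fresh m ρ (nf ∘ f-outM₁)) (subst-fresh σ ρ (nf ∘ f-outM₂))
  subst-fresh (ext bs) ρ nf = cong ext (substB-fresh bs ρ (λ mem → nf ∘ f-ext mem))
  subst-fresh (int bs) ρ nf = cong int (substB-fresh bs ρ (λ mem → nf ∘ f-int mem))
  subst-fresh {x} (μ y σ) ρ nf with y ≟ x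
  ... | yes _ = refl
  ... | no y≢x = cong (μ y) (subst-fresh σ ρ (nf ∘ f-μ y≢x))
  subst-fresh {x} (var y) ρ nf with y ≟ x
  ... | yes refl = ⊥-elim (nf f-var)
  ... | no _ = refl
  substB-fresh [ l ↦ σ ] ρ nf = cong [ l ↦_] (subst-fresh σ ρ (nf here₁))
  substB-fresh (l ↦ σ ∷ bs) ρ nf = cong₂ (l ↦_∷_) (subst-fresh σ ρ (nf here)) (substB-fresh bs ρ (nf ∘ there))

  subst-closed : ∀ {x} (σ : Ct) ρ → Closed σ → σ [ ρ / x ] ≡ σ
  subst-closed {x} σ ρ c = subst-fresh σ ρ (c x)

  unguarded⇒free : ∀ {y} {σ : Ct} → Unguarded y σ → FreeIn y σ
  unguarded⇒free ug-var = f-var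
  unguarded⇒free (ug-μ n u) = f-μ n (unguarded⇒free u)

  unguarded-subst⁻ : ∀ {x y} {ρ : Ct} → Closed ρ → (σ : Ct) → Unguarded y (σ [ ρ / x ]) → Unguarded y σ
  unguarded-subst⁻ {x} c (var z) u with z ≟ x
  ... | yes refl = ⊥-elim (c _ (unguarded⇒free u))
  ... | no _ = u
  unguarded-subst⁻ {x} c (μ z σ) u with z ≟ x
  ... | yes _ = u
  unguarded-subst⁻ {x} c (μ z σ) (ug-μ n u) | no _ = ug-μ n (unguarded-subst⁻ c σ u)
  unguarded-subst⁻ c 𝟏 ()
  unguarded-subst⁻ c (inT _ _) ()
  unguarded-subst⁻ c (outT _ _) ()
  unguarded-subst⁻ c (inM _ _) ()
  unguarded-subst⁻ c (outM _ _) ()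
  unguarded-subst⁻ c (ext _) ()
  unguarded-subst⁻ c (int _) ()

  ∈-substB⁻ : ∀ {x l σ} {ρ : Ct} (bs : Bs) → l ↦ σ ∈ (bs [ ρ / x ]B) →
    ∃ λ σ₀ → l ↦ σ₀ ∈ bs × σ ≡ σ₀ [ ρ / x ]
  ∈-substB⁻ [ l ↦ σ ] here₁ = σ , here₁ , refl
  ∈-substB⁻ (l ↦ σ ∷ bs) here = σ , here , refl
  ∈-substB⁻ (l ↦ σ ∷ bs) (there m) = Prod.map₂ (Prod.map₁ there) (∈-substB⁻ bs m)

  labels-substB : ∀ {x} {ρ : Ct} (bs : Bs) → labels (bs [ ρ / x ]B) ≡ labels bs
  labels-substB [ l ↦ σ ] = refl
  labels-substB (l ↦ σ ∷ bs) = cong (l ∷_) (labels-substB bs)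

  free-subst : ∀ {x y} (α : Ct) ρ → FreeIn y (α [ ρ / x ]) → FreeIn y ρ ⊎ (x ≢ y × FreeIn y α)
  free-subst 𝟏 ρ ()
  free-subst (inT t σ) ρ (f-inT p) = Sum.map₂ (Prod.map₂ f-inT) (free-subst σ ρ p)
  free-subst (outT t σ) ρ (f-outT p) = Sum.map₂ (Prod.map₂ f-outT) (free-subst σ ρ p)
  free-subst (inM m σ) ρ (f-inM₁ p) = Sum.map₂ (Prod.map₂ f-inM₁) (free-subst m ρ p)
  free-subst (inM m σ) ρ (f-inM₂ p) = Sum.map₂ (Prod.map₂ f-inM₂) (free-subst σ ρ p)
  free-subst (outM m σ) ρ (f-outM₁ p) = Sum.map₂ (Prod.map₂ f-outM₁) (free-subst m ρ p)
  free-subst (outM m σ) ρ (f-outM₂ p) = Sum.map₂ (Prod.map₂ f-outM₂) (free-subst σ ρ p)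
  free-subst (ext bs) ρ (f-ext mem p) with ∈-substB⁻ bs mem
  ... | σ₀ , mem' , refl = Sum.map₂ (Prod.map₂ (f-ext mem')) (free-subst σ₀ ρ p)
  free-subst (int bs) ρ (f-int mem p) with ∈-substB⁻ bs mem
  ... | σ₀ , mem' , refl = Sum.map₂ (Prod.map₂ (f-int mem')) (free-subst σ₀ ρ p)
  free-subst {x} (μ z σ) ρ p with z ≟ x
  free-subst {x} (μ z σ) ρ (f-μ z≢y q) | yes refl = inj₂ (z≢y , f-μ z≢y q)
  free-subst {x} (μ z σ) ρ (f-μ z≢y q) | no _ = Sum.map₂ (Prod.map₂ (f-μ z≢y)) (free-subst σ ρ q)
  free-subst {x} (var z) ρ p with z ≟ x
  free-subst {x} (var z) ρ p | yes refl = inj₁ p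
  free-subst {x} (var z) ρ f-var | no z≢x = inj₂ (z≢x ∘ sym , f-var)

  -- A subterm k₀ of α survives in α [ ρ / x ] unchanged when it lies under a μ x.
  ◃-subst⁻ : ∀ {x k} {ρ : Ct} (k₀ : Ct) → k ◃ (k₀ [ ρ / x ]) →
    Subterm k ρ ⊎ ∃ λ k₁ → k₁ ◃ k₀ × (k ≡ k₁ ⊎ k ≡ k₁ [ ρ / x ])
  ◃-subst⁻ 𝟏 ()
  ◃-subst⁻ (inT t σ) s-inT = inj₂ (σ , s-inT , inj₂ refl)
  ◃-subst⁻ (outT t σ) s-outT = inj₂ (σ , s-outT , inj₂ refl)
  ◃-subst⁻ (inM m σ) s-inM₁ = inj₂ (m , s-inM₁ , inj₂ refl)
  ◃-subst⁻ (inM m σ) s-inM₂ = inj₂ (σ , s-inM₂ , inj₂ refl)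
  ◃-subst⁻ (outM m σ) s-outM₁ = inj₂ (m , s-outM₁ , inj₂ refl)
  ◃-subst⁻ (outM m σ) s-outM₂ = inj₂ (σ , s-outM₂ , inj₂ refl)
  ◃-subst⁻ (ext bs) (s-ext mem) with ∈-substB⁻ bs mem
  ... | σ₀ , mem' , e = inj₂ (σ₀ , s-ext mem' , inj₂ e)
  ◃-subst⁻ (int bs) (s-int mem) with ∈-substB⁻ bs mem
  ... | σ₀ , mem' , e = inj₂ (σ₀ , s-int mem' , inj₂ e)
  ◃-subst⁻ {x} (μ y σ) p with y ≟ x
  ◃-subst⁻ {x} (μ y σ) s-μ | yes _ = inj₂ (σ , s-μ , inj₁ refl)
  ◃-subst⁻ {x} (μ y σ) s-μ | no _ = inj₂ (σ , s-μ , inj₂ refl)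
  ◃-subst⁻ {x} (var y) p with y ≟ x
  ... | yes _ = inj₁ (p ◅ ε)
  ◃-subst⁻ {x} (var y) () | no _

  subterm-subst⁻ : ∀ {x k} {ρ : Ct} (α : Ct) → Subterm k (α [ ρ / x ]) →
    Subterm k ρ ⊎ ∃ λ k₀ → Subterm k₀ α × (k ≡ k₀ ⊎ k ≡ k₀ [ ρ / x ])
  subterm-subst⁻ α ε = inj₂ (α , ε , inj₂ refl)
  subterm-subst⁻ α (p ◅ ps) with subterm-subst⁻ α ps
  ... | inj₁ s = inj₁ (p ◅ s)
  ... | inj₂ (k₀ , s , inj₁ refl) = inj₂ (_ , p ◅ s , inj₁ refl)
  ... | inj₂ (k₀ , s , inj₂ refl) with ◃-subst⁻ k₀ p
  ...   | inj₁ s' = inj₁ s'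
  ...   | inj₂ (k₁ , q , e) = inj₂ (k₁ , q ◅ s , e)

  LocallySC : Ct → Set
  LocallySC (ext bs) = Unique (labels bs)
  LocallySC (int bs) = Unique (labels bs)
  LocallySC (μ x σ) = ¬ Unguarded x σ
  LocallySC _ = ⊤

  HereditarilySC : Ct → Set
  HereditarilySC σ = ∀ {k} → Subterm k σ → LocallySC k

  sc⇒hereditarilySC : ∀ {σ : Ct} → IsSC σ → HereditarilySC σ
  sc⇒hereditarilySC ((dl₁ , _) , _ , _) {ext _} s = dl₁ s
  sc⇒hereditarilySC ((_ , dl₂) , _ , _) {int _} s = dl₂ s
  sc⇒hereditarilySC (_ , g , _) {μ _ _} s = g s
  sc⇒hereditarilySC _ {𝟏} _ = tt
  sc⇒hereditarilySC _ {inT _ _} _ = tt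
  sc⇒hereditarilySC _ {outT _ _} _ = tt
  sc⇒hereditarilySC _ {inM _ _} _ = tt
  sc⇒hereditarilySC _ {outM _ _} _ = tt
  sc⇒hereditarilySC _ {var _} _ = tt

  hereditarilySC⇒sc : ∀ {σ : Ct} → HereditarilySC σ → Closed σ → IsSC σ
  hereditarilySC⇒sc h c = ((λ s → h s) , (λ s → h s)) , (λ s → h s) , c

  locallySC-subst : ∀ {x} {ρ : Ct} → Closed ρ → LocallySC ρ → (k : Ct) → LocallySC k →
    LocallySC (k [ ρ / x ])
  locallySC-subst _ _ (ext bs) u = subst Unique (sym (labels-substB bs)) u
  locallySC-subst _ _ (int bs) u = subst Unique (sym (labels-substB bs)) u
  locallySC-subst {x} c _ (μ y σ) g with y ≟ x
  ... | yes _ = g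
  ... | no _ = g ∘ unguarded-subst⁻ c σ
  locallySC-subst {x} _ lρ (var y) _ with y ≟ x
  ... | yes _ = lρ
  ... | no _ = tt
  locallySC-subst _ _ 𝟏 _ = tt
  locallySC-subst _ _ (inT _ _) _ = tt
  locallySC-subst _ _ (outT _ _) _ = tt
  locallySC-subst _ _ (inM _ _) _ = tt
  locallySC-subst _ _ (outM _ _) _ = tt

  hereditarilySC-subst : ∀ {x} {ρ : Ct} (α : Ct) → Closed ρ → HereditarilySC ρ → HereditarilySC α →
    HereditarilySC (α [ ρ / x ])
  hereditarilySC-subst α cρ hρ hα s with subterm-subst⁻ α s
  ... | inj₁ s' = hρ s'
  ... | inj₂ (k₀ , s' , inj₁ refl) = hα s'
  ... | inj₂ (k₀ , s' , inj₂ refl) = locallySC-subst cρ (hρ ε) k₀ (hα s')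

  sc-unfold : ∀ {x} {α : Ct} → IsSC (μ x α) → IsSC (α [ μ x α / x ])
  sc-unfold {x} {α} sc@(_ , _ , c) = hereditarilySC⇒sc hereditary closed
    where
    hereditary : HereditarilySC (α [ μ x α / x ])
    hereditary = hereditarilySC-subst α c (sc⇒hereditarilySC sc) (λ s → sc⇒hereditarilySC sc (s ◅◅ s-μ ◅ ε))
    closed : Closed (α [ μ x α / x ])
    closed y f with free-subst α (μ x α) f
    ... | inj₁ q = c y q
    ... | inj₂ (x≢y , q) = c y (f-μ x≢y q)

  sc-◃ : ∀ {a b : Ct} → IsSC a → b ◃ a → (∀ {y} → FreeIn y b → FreeIn y a) → IsSC b
  sc-◃ sc@(_ , _ , c) p free⇒free =
    hereditarilySC⇒sc (λ s → sc⇒hereditarilySC sc (s ◅◅ p ◅ ε)) (λ y → c y ∘ free⇒free)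

  subterm-split : ∀ {k σ : Ct} → Subterm k σ → k ≡ σ ⊎ ∃ λ a → Subterm k a × a ◃ σ
  subterm-split ε = inj₁ refl
  subterm-split (p ◅ ps) with subterm-split ps
  ... | inj₁ refl = inj₂ (_ , ε , p)
  ... | inj₂ (a , qs , q) = inj₂ (a , p ◅ qs , q)

  sc-choose : ∀ {l γ l' σ'} {bs : Bs} → IsSC (int (l' ↦ σ' ∷ bs)) → l ↦ γ ∈ (l' ↦ σ' ∷ bs) →
    IsSC (int [ l ↦ γ ])
  sc-choose {l} {γ} sc@(_ , _ , c) mem = hereditarilySC⇒sc hereditary λ { y (f-int here₁ q) → c y (f-int mem q) }
    where
    hereditary : HereditarilySC (int [ l ↦ γ ])
    hereditary s with subterm-split s
    ... | inj₁ refl = [] ∷ []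
    ... | inj₂ (_ , s' , s-int here₁) = sc⇒hereditarilySC sc (s' ◅◅ s-int mem ◅ ε)

  sc-step : ∀ {a b : Ct} {v} → IsSC a → a —[ v ]→ b → IsSC b
  sc-step sc st-inT = sc-◃ sc s-inT f-inT
  sc-step sc st-outT = sc-◃ sc s-outT f-outT
  sc-step sc st-inM = sc-◃ sc s-inM₂ f-inM₂
  sc-step sc st-outM = sc-◃ sc s-outM₂ f-outM₂
  sc-step sc (st-ext mem) = sc-◃ sc (s-ext mem) (f-ext mem)
  sc-step sc st-out = sc-◃ sc (s-int here₁) (f-int here₁)
  sc-step sc (st-int mem) = sc-choose sc mem
  sc-step sc st-μ = sc-unfold sc

  ∈-dualB : ∀ {l γ} {bs : Bs} → l ↦ γ ∈ bs → l ↦ dual γ ∈ dualB bs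
  ∈-dualB here₁ = here₁
  ∈-dualB here = here
  ∈-dualB (there m) = there (∈-dualB m)

  ∈-dualB⁻ : ∀ {l δ} (bs : Bs) → l ↦ δ ∈ dualB bs → ∃ λ γ → l ↦ γ ∈ bs × δ ≡ dual γ
  ∈-dualB⁻ [ l ↦ σ ] here₁ = σ , here₁ , refl
  ∈-dualB⁻ (l ↦ σ ∷ bs) here = σ , here , refl
  ∈-dualB⁻ (l ↦ σ ∷ bs) (there m) = Prod.map₂ (Prod.map₁ there) (∈-dualB⁻ bs m)

  labels-dualB : (bs : Bs) → labels (dualB bs) ≡ labels bs
  labels-dualB [ l ↦ σ ] = refl
  labels-dualB (l ↦ σ ∷ bs) = cong (l ∷_) (labels-dualB bs)

  free-dual⁻ : ∀ {y} (σ : Ct) → FreeIn y (dual σ) → FreeIn y σ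
  free-dual⁻ 𝟏 ()
  free-dual⁻ (var x) p = p
  free-dual⁻ (μ x σ) (f-μ n p) = f-μ n (free-dual⁻ σ p)
  free-dual⁻ (inT t σ) (f-outT p) = f-inT (free-dual⁻ σ p)
  free-dual⁻ (outT t σ) (f-inT p) = f-outT (free-dual⁻ σ p)
  free-dual⁻ (inM m σ) (f-outM₁ p) = f-inM₁ p
  free-dual⁻ (inM m σ) (f-outM₂ p) = f-inM₂ (free-dual⁻ σ p)
  free-dual⁻ (outM m σ) (f-inM₁ p) = f-outM₁ p
  free-dual⁻ (outM m σ) (f-inM₂ p) = f-outM₂ (free-dual⁻ σ p)
  free-dual⁻ (ext bs) (f-int mem p) with ∈-dualB⁻ bs mem
  ... | γ , mem' , refl = f-ext mem' (free-dual⁻ γ p)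
  free-dual⁻ (int bs) (f-ext mem p) with ∈-dualB⁻ bs mem
  ... | γ , mem' , refl = f-int mem' (free-dual⁻ γ p)

  -- Messages are not dualised, so a subterm of dual α is either dual k₀ or a message k₀ of α.
  ◃-dual⁻ : ∀ {k} (k₀ : Ct) → k ◃ dual k₀ → ∃ λ k₁ → k₁ ◃ k₀ × (k ≡ dual k₁ ⊎ k ≡ k₁)
  ◃-dual⁻ 𝟏 ()
  ◃-dual⁻ (var x) ()
  ◃-dual⁻ (μ x σ) s-μ = σ , s-μ , inj₁ refl
  ◃-dual⁻ (inT t σ) s-outT = σ , s-inT , inj₁ refl
  ◃-dual⁻ (outT t σ) s-inT = σ , s-outT , inj₁ refl
  ◃-dual⁻ (inM m σ) s-outM₁ = m , s-inM₁ , inj₂ refl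
  ◃-dual⁻ (inM m σ) s-outM₂ = σ , s-inM₂ , inj₁ refl
  ◃-dual⁻ (outM m σ) s-inM₁ = m , s-outM₁ , inj₂ refl
  ◃-dual⁻ (outM m σ) s-inM₂ = σ , s-outM₂ , inj₁ refl
  ◃-dual⁻ (ext bs) (s-int mem) with ∈-dualB⁻ bs mem
  ... | γ , mem' , e = γ , s-ext mem' , inj₁ e
  ◃-dual⁻ (int bs) (s-ext mem) with ∈-dualB⁻ bs mem
  ... | γ , mem' , e = γ , s-int mem' , inj₁ e

  subterm-dual⁻ : ∀ {k} (α : Ct) → Subterm k (dual α) → ∃ λ k₀ → Subterm k₀ α × (k ≡ dual k₀ ⊎ k ≡ k₀)
  subterm-dual⁻ α ε = α , ε , inj₁ refl
  subterm-dual⁻ α (p ◅ ps) with subterm-dual⁻ α ps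
  ... | k₀ , s , inj₂ refl = _ , p ◅ s , inj₂ refl
  ... | k₀ , s , inj₁ refl with ◃-dual⁻ k₀ p
  ...   | k₁ , q , e = k₁ , q ◅ s , e

  unguarded-dual⁻ : ∀ {y} (σ : Ct) → Unguarded y (dual σ) → Unguarded y σ
  unguarded-dual⁻ (var x) ug-var = ug-var
  unguarded-dual⁻ (μ x σ) (ug-μ n u) = ug-μ n (unguarded-dual⁻ σ u)
  unguarded-dual⁻ 𝟏 ()
  unguarded-dual⁻ (inT _ _) ()
  unguarded-dual⁻ (outT _ _) ()
  unguarded-dual⁻ (inM _ _) ()
  unguarded-dual⁻ (outM _ _) ()
  unguarded-dual⁻ (ext _) ()
  unguarded-dual⁻ (int _) ()

  locallySC-dual : (k : Ct) → LocallySC k → LocallySC (dual k)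
  locallySC-dual (ext bs) u = subst Unique (sym (labels-dualB bs)) u
  locallySC-dual (int bs) u = subst Unique (sym (labels-dualB bs)) u
  locallySC-dual (μ x σ) g = g ∘ unguarded-dual⁻ σ
  locallySC-dual 𝟏 _ = tt
  locallySC-dual (var _) _ = tt
  locallySC-dual (inT _ _) _ = tt
  locallySC-dual (outT _ _) _ = tt
  locallySC-dual (inM _ _) _ = tt
  locallySC-dual (outM _ _) _ = tt

  sc-dual : ∀ {ρ : Ct} → IsSC ρ → IsSC (dual ρ)
  sc-dual {ρ} sc@(_ , _ , c) = hereditarilySC⇒sc hereditary (λ y → c y ∘ free-dual⁻ ρ)
    where
    hereditary : HereditarilySC (dual ρ)
    hereditary s with subterm-dual⁻ ρ s
    ... | k₀ , s' , inj₁ refl = locallySC-dual k₀ (sc⇒hereditarilySC sc s')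
    ... | k₀ , s' , inj₂ refl = sc⇒hereditarilySC sc s'

  -- Both sides of dual-subst keep the message m because it is closed.
  dual-subst : ∀ {x} {ρ α : Ct} → MClosed α → dual (α [ ρ / x ]) ≡ dual α [ dual ρ / x ]
  dualB-substB : ∀ {x} {ρ : Ct} {bs : Bs} → MClosedB bs → dualB (bs [ ρ / x ]B) ≡ dualB bs [ dual ρ / x ]B
  dual-subst mc-𝟏 = refl
  dual-subst {x} (mc-var {y}) with y ≟ x
  ... | yes _ = refl
  ... | no _ = refl
  dual-subst {x} (mc-μ {y} m) with y ≟ x
  ... | yes _ = refl
  ... | no _ = cong (μ _) (dual-subst m)
  dual-subst {x} {ρ} (mc-outM {m} c mσ) =
    cong₂ inM (trans (subst-closed m ρ c) (sym (subst-closed m (dual ρ) c))) (dual-subst mσ)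
  dual-subst {x} {ρ} (mc-inM {m} c mσ) =
    cong₂ outM (trans (subst-closed m ρ c) (sym (subst-closed m (dual ρ) c))) (dual-subst mσ)
  dual-subst (mc-inT m) = cong (outT _) (dual-subst m)
  dual-subst (mc-outT m) = cong (inT _) (dual-subst m)
  dual-subst (mc-ext b) = cong int (dualB-substB b)
  dual-subst (mc-int b) = cong ext (dualB-substB b)
  dualB-substB (mcb-[] m) = cong [ _ ↦_] (dual-subst m)
  dualB-substB (mcb-∷ m b) = cong₂ (_ ↦_∷_) (dual-subst m) (dualB-substB b)

  mclosed-subst : ∀ {x} {ρ α : Ct} → MClosed α → MClosed ρ → MClosed (α [ ρ / x ])
  mclosedB-substB : ∀ {x} {ρ : Ct} {bs : Bs} → MClosedB bs → MClosed ρ → MClosedB (bs [ ρ / x ]B)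
  mclosed-subst mc-𝟏 mρ = mc-𝟏
  mclosed-subst {x} (mc-var {y}) mρ with y ≟ x
  ... | yes _ = mρ
  ... | no _ = mc-var
  mclosed-subst {x} (mc-μ {y} m) mρ with y ≟ x
  ... | yes _ = mc-μ m
  ... | no _ = mc-μ (mclosed-subst m mρ)
  mclosed-subst {x} {ρ} (mc-outM {m} c mσ) mρ =
    mc-outM (subst Closed (sym (subst-closed m ρ c)) c) (mclosed-subst mσ mρ)
  mclosed-subst {x} {ρ} (mc-inM {m} c mσ) mρ =
    mc-inM (subst Closed (sym (subst-closed m ρ c)) c) (mclosed-subst mσ mρ)
  mclosed-subst (mc-inT m) mρ = mc-inT (mclosed-subst m mρ)
  mclosed-subst (mc-outT m) mρ = mc-outT (mclosed-subst m mρ)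
  mclosed-subst (mc-ext b) mρ = mc-ext (mclosedB-substB b mρ)
  mclosed-subst (mc-int b) mρ = mc-int (mclosedB-substB b mρ)
  mclosedB-substB (mcb-[] m) mρ = mcb-[] (mclosed-subst m mρ)
  mclosedB-substB (mcb-∷ m b) mρ = mcb-∷ (mclosed-subst m mρ) (mclosedB-substB b mρ)

  mclosed-∈ : ∀ {l γ} {bs : Bs} → MClosedB bs → l ↦ γ ∈ bs → MClosed γ
  mclosed-∈ (mcb-[] m) here₁ = m
  mclosed-∈ (mcb-∷ m b) here = m
  mclosed-∈ (mcb-∷ m b) (there mem) = mclosed-∈ b mem

  ∉-labels : ∀ {l l' b} {bs : Bs} → All (l ≢_) (labels bs) → l' ↦ b ∈ bs → l ≢ l'
  ∉-labels (l≢ ∷ []) here₁ = l≢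
  ∉-labels (l≢ ∷ _) here = l≢
  ∉-labels (_ ∷ l≢s) (there m) = ∉-labels l≢s m

  ∈-functional : ∀ {l a b} {bs : Bs} → Unique (labels bs) → l ↦ a ∈ bs → l ↦ b ∈ bs → a ≡ b
  ∈-functional u here₁ here₁ = refl
  ∈-functional u here here = refl
  ∈-functional (l∉ ∷ _) here (there m) = ⊥-elim (∉-labels l∉ m refl)
  ∈-functional (l∉ ∷ _) (there m) here = ⊥-elim (∉-labels l∉ m refl)
  ∈-functional (_ ∷ u) (there m) (there m') = ∈-functional u m m'

  data Unfolding : Ct → Ct → Set where
    unfold : ∀ {x α} → Unfolding (μ x α) (α [ μ x α / x ])

  Unfoldings : Ct → Ct → Set
  Unfoldings = Star Unfolding

  unfoldings-dual : ∀ {a b} → MClosed a → Unfoldings a b → Unfoldings (dual a) (dual b) × MClosed b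
  unfoldings-dual m ε = ε , m
  unfoldings-dual {μ x α} (mc-μ m) (unfold ◅ us) =
    Prod.map₁ (subst (Unfolding (μ x (dual α))) (sym (dual-subst m)) unfold ◅_)
              (unfoldings-dual (mclosed-subst m (mc-μ m)) us)

  sc-unfoldings : ∀ {a b} → IsSC a → Unfoldings a b → IsSC b
  sc-unfoldings sc ε = sc
  sc-unfoldings sc (unfold ◅ us) = sc-unfoldings (sc-unfold sc) us

  NonMu : Ct → Set
  NonMu (μ _ _) = ⊥
  NonMu _ = ⊤

  nonMu-dual : (a : Ct) → NonMu a → NonMu (dual a)
  nonMu-dual 𝟏 n = tt
  nonMu-dual (var _) n = tt
  nonMu-dual (inT _ _) n = tt
  nonMu-dual (outT _ _) n = tt
  nonMu-dual (inM _ _) n = tt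
  nonMu-dual (outM _ _) n = tt
  nonMu-dual (ext _) n = tt
  nonMu-dual (int _) n = tt

  nonMu-or-μ : (a : Ct) → NonMu a ⊎ ∃₂ λ x α → a ≡ μ x α
  nonMu-or-μ (μ x α) = inj₂ (x , α , refl)
  nonMu-or-μ 𝟏 = inj₁ tt
  nonMu-or-μ (var _) = inj₁ tt
  nonMu-or-μ (inT _ _) = inj₁ tt
  nonMu-or-μ (outT _ _) = inj₁ tt
  nonMu-or-μ (inM _ _) = inj₁ tt
  nonMu-or-μ (outM _ _) = inj₁ tt
  nonMu-or-μ (ext _) = inj₁ tt
  nonMu-or-μ (int _) = inj₁ tt

  unfoldings-deterministic : ∀ {a b c} → Unfoldings a b → Unfoldings a c → NonMu b → NonMu c → b ≡ c
  unfoldings-deterministic ε ε nb nc = refl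
  unfoldings-deterministic ε (unfold ◅ _) nb nc = ⊥-elim nb
  unfoldings-deterministic (unfold ◅ _) ε nb nc = ⊥-elim nc
  unfoldings-deterministic (unfold ◅ us) (unfold ◅ vs) nb nc = unfoldings-deterministic us vs nb nc

  unfoldings-dual-aligned : ∀ {ρ₀ ρ₁ σ₁} → MClosed ρ₀ → Unfoldings ρ₀ ρ₁ → Unfoldings (dual ρ₀) σ₁ →
    NonMu ρ₁ → NonMu σ₁ → σ₁ ≡ dual ρ₁
  unfoldings-dual-aligned {ρ₁ = ρ₁} m u v nρ nσ =
    unfoldings-deterministic v (proj₁ (unfoldings-dual m u)) nσ (nonMu-dual ρ₁ nρ)

  data Resolved : Ct → Ct → Set where
    as-is  : ∀ {a} → Resolved a a
    chosen : ∀ {l γ l' σ' bs} → l ↦ γ ∈ (l' ↦ σ' ∷ bs) → Resolved (int (l' ↦ σ' ∷ bs)) (int [ l ↦ γ ])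

  sc-resolved : ∀ {a b} → IsSC a → Resolved a b → IsSC b
  sc-resolved sc as-is = sc
  sc-resolved sc (chosen mem) = sc-choose sc mem

module Compliance (BT : Set) (_≤:_ : BT → BT → Set) (≤:-refl : ∀ {t} → t ≤: t)
                  (B : Contract BT → Contract BT → Set) (B-refl : ∀ {σ} → IsSC σ → B σ σ) where
  private
    Ct = Contract BT

  Sync : Act → Act → Set
  Sync = _⋈_ _≤:_ B

  Step : Ct → Ct → Ct → Ct → Set
  Step = PStep _≤:_ B

  data Residual (ρ σ : Ct) : Set where
    residual : ∀ {ρ₀ ρ₁ σ₁} → IsSC ρ₀ → MClosed ρ₀ →
      Unfoldings ρ₀ ρ₁ → Resolved ρ₁ ρ → Unfoldings (dual ρ₀) σ₁ → Resolved σ₁ σ → Residual ρ σ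

  residual-dual : ∀ {ρ} → IsSC ρ → MClosed ρ → Residual ρ (dual ρ)
  residual-dual sc mc = residual sc mc ε as-is ε as-is

  sc-residual : ∀ {ρ σ} → Residual ρ σ → IsSC ρ × IsSC σ
  sc-residual (residual sc₀ _ u r v s) =
    sc-resolved (sc-unfoldings sc₀ u) r , sc-resolved (sc-unfoldings (sc-dual sc₀) v) s

  resolved-τ : ∀ {ρ₀ ρ₁ ρ ρ' : Ct} → Unfoldings ρ₀ ρ₁ → Resolved ρ₁ ρ → ρ —[ τ ]→ ρ' →
    ∃ λ ρ₁' → Unfoldings ρ₀ ρ₁' × Resolved ρ₁' ρ'
  resolved-τ u as-is st-μ = _ , u ◅◅ unfold ◅ ε , as-is
  resolved-τ u as-is (st-int m) = _ , u , chosen m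
  resolved-τ u (chosen m) ()

  nonMu-syncˡ : ∀ {ρ₁ ρ ρ' a₁ a₂} → Resolved ρ₁ ρ → ρ —[ a₁ ]→ ρ' → Sync a₁ a₂ → NonMu ρ₁
  nonMu-syncˡ (chosen _) _ _ = tt
  nonMu-syncˡ as-is st-inT _ = tt
  nonMu-syncˡ as-is st-outT _ = tt
  nonMu-syncˡ as-is st-inM _ = tt
  nonMu-syncˡ as-is st-outM _ = tt
  nonMu-syncˡ as-is (st-ext _) _ = tt
  nonMu-syncˡ as-is st-out _ = tt
  nonMu-syncˡ as-is (st-int _) ()
  nonMu-syncˡ as-is st-μ ()

  nonMu-syncʳ : ∀ {σ₁ σ σ' a₁ a₂} → Resolved σ₁ σ → σ —[ a₂ ]→ σ' → Sync a₁ a₂ → NonMu σ₁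
  nonMu-syncʳ (chosen _) _ _ = tt
  nonMu-syncʳ as-is st-inT _ = tt
  nonMu-syncʳ as-is st-outT _ = tt
  nonMu-syncʳ as-is st-inM _ = tt
  nonMu-syncʳ as-is st-outM _ = tt
  nonMu-syncʳ as-is (st-ext _) _ = tt
  nonMu-syncʳ as-is st-out _ = tt
  nonMu-syncʳ as-is (st-int _) ()
  nonMu-syncʳ as-is st-μ ()

  -- When ext bs meets a resolved choice of dual (ext bs), the label picks the dual branch
  -- because the labels of bs are distinct.
  sync-dual : ∀ {ρ₁ ρ σ ρ' σ' a₁ a₂} → IsSC ρ₁ → MClosed ρ₁ → Resolved ρ₁ ρ → Resolved (dual ρ₁) σ →
    ρ —[ a₁ ]→ ρ' → σ —[ a₂ ]→ σ' → Sync a₁ a₂ → MClosed ρ' × σ' ≡ dual ρ'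
  sync-dual sc (mc-μ m) as-is _ st-μ _ ()
  sync-dual sc (mc-inT m) as-is as-is st-inT st-outT _ = m , refl
  sync-dual sc (mc-outT m) as-is as-is st-outT st-inT _ = m , refl
  sync-dual sc (mc-inM c m) as-is as-is st-inM st-outM _ = m , refl
  sync-dual sc (mc-outM c m) as-is as-is st-outM st-inM _ = m , refl
  sync-dual sc (mc-ext (mcb-[] m)) as-is as-is (st-ext here₁) st-out _ = m , refl
  sync-dual {ext bs} sc (mc-ext mb@(mcb-∷ _ _)) as-is (chosen mem') (st-ext mem) st-out ⋈-?!
    with ∈-dualB⁻ bs mem'
  ... | _ , mem₁ , e = mclosed-∈ mb mem , trans e (cong dual (∈-functional (proj₁ (proj₁ sc) ε) mem₁ mem))
  sync-dual sc (mc-int (mcb-[] m)) as-is as-is st-out (st-ext here₁) _ = m , refl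
  sync-dual sc (mc-int (mcb-∷ _ _)) as-is _ (st-int _) _ ()
  sync-dual {int bs} sc (mc-int mb@(mcb-∷ _ _)) (chosen mem) as-is st-out (st-ext mem') ⋈-!?
    with ∈-dualB⁻ bs mem'
  ... | _ , mem₁ , e = mclosed-∈ mb mem , trans e (cong dual (∈-functional (proj₂ (proj₁ sc) ε) mem₁ mem))

  Progress : Ct → Ct → Set
  Progress ρ σ = (HasOk ρ × HasOk σ) ⊎ ∃₂ λ ρ' σ' → Step ρ σ ρ' σ'

  progress-dual : ∀ {ρ₁ ρ σ} → IsSC ρ₁ → Resolved ρ₁ ρ → Resolved (dual ρ₁) σ → NonMu ρ₁ → Progress ρ σ
  progress-dual {𝟏} sc as-is as-is _ = inj₁ (ok𝟏 , ok𝟏)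
  progress-dual {var x} (_ , _ , c) as-is as-is _ = ⊥-elim (c x f-var)
  progress-dual {inT t α} sc as-is as-is _ = inj₂ (_ , _ , sync st-inT st-outT (⋈-?!t ≤:-refl))
  progress-dual {outT t α} sc as-is as-is _ = inj₂ (_ , _ , sync st-outT st-inT (⋈-!?t ≤:-refl))
  progress-dual {inM m α} sc as-is as-is _ =
    inj₂ (_ , _ , sync st-inM st-outM (⋈-?!m (B-refl (sc-◃ sc s-inM₁ f-inM₁))))
  progress-dual {outM m α} sc as-is as-is _ =
    inj₂ (_ , _ , sync st-outM st-inM (⋈-!?m (B-refl (sc-◃ sc s-outM₁ f-outM₁))))
  progress-dual {ext [ l ↦ γ ]} sc as-is as-is _ = inj₂ (_ , _ , sync (st-ext here₁) st-out ⋈-?!)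
  progress-dual {ext (l ↦ γ ∷ bs)} sc as-is as-is _ = inj₂ (_ , _ , right (st-int here))
  progress-dual {ext (l ↦ γ ∷ bs)} sc as-is (chosen mem) _ with ∈-dualB⁻ (l ↦ γ ∷ bs) mem
  ... | _ , mem₁ , _ = inj₂ (_ , _ , sync (st-ext mem₁) st-out ⋈-?!)
  progress-dual {int [ l ↦ γ ]} sc as-is as-is _ = inj₂ (_ , _ , sync st-out (st-ext here₁) ⋈-!?)
  progress-dual {int (l ↦ γ ∷ bs)} sc as-is _ _ = inj₂ (_ , _ , left (st-int here))
  progress-dual {int (l ↦ γ ∷ bs)} sc (chosen mem) as-is _ =
    inj₂ (_ , _ , sync st-out (st-ext (∈-dualB mem)) ⋈-!?)
  progress-dual {μ x α} sc _ _ ()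

  residual-progress : ∀ {ρ σ} → Residual ρ σ → Progress ρ σ
  residual-progress (residual {ρ₁ = ρ₁} {σ₁} sc₀ m₀ u r v s) with nonMu-or-μ ρ₁ | nonMu-or-μ σ₁
  ... | inj₂ (_ , _ , refl) | _ with r
  ...   | as-is = inj₂ (_ , _ , left st-μ)
  residual-progress (residual sc₀ m₀ u r v s) | inj₁ _ | inj₂ (_ , _ , refl) with s
  ...   | as-is = inj₂ (_ , _ , right st-μ)
  residual-progress (residual sc₀ m₀ u r v s) | inj₁ nρ | inj₁ nσ
    with refl ← unfoldings-dual-aligned m₀ u v nρ nσ = progress-dual (sc-unfoldings sc₀ u) r s nρ

  residual-step : ∀ {ρ σ ρ' σ'} → Residual ρ σ → Step ρ σ ρ' σ' → Residual ρ' σ'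
  residual-step (residual sc₀ m₀ u r v s) (left st)
    with _ , u' , r' ← resolved-τ u r st = residual sc₀ m₀ u' r' v s
  residual-step (residual sc₀ m₀ u r v s) (right st)
    with _ , v' , s' ← resolved-τ v s st = residual sc₀ m₀ u r v' s'
  residual-step res@(residual sc₀ m₀ u r v s) (sync st₁ st₂ k)
    with refl ← unfoldings-dual-aligned m₀ u v (nonMu-syncˡ r st₁ k) (nonMu-syncʳ s st₂ k)
    with mρ' , refl ← sync-dual (sc-unfoldings sc₀ u) (proj₂ (unfoldings-dual m₀ u)) r s st₁ st₂ k
    = residual-dual (sc-step (proj₁ (sc-residual res)) st₁) mρ'

  residual-compliance : IsComplianceRel _≤:_ B Residual
  residual-compliance = sc-residual , stuck⇒ok , residual-step
    where
    stuck⇒ok : ∀ {ρ σ} → Residual ρ σ → ¬ (∃₂ λ ρ' σ' → Step ρ σ ρ' σ') → HasOk ρ × HasOk σ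
    stuck⇒ok res stuck with residual-progress res
    ... | inj₁ ok = ok
    ... | inj₂ step = ⊥-elim (stuck step)

theorem5p7 : (BT : Set) (_≤:_ : BT → BT → Set) → IsPreorder _≡_ _≤:_ →
    (B : Contract BT → Contract BT → Set) → IsPreorderOnSC B →
    (ρ : Contract BT) → IsSC ρ → MClosed ρ →
    _⊨_ _≤:_ B ρ (dual ρ)
theorem5p7 BT _≤:_ isPreorder B (_ , B-refl , _) ρ sc mc =
  Residual , residual-compliance , residual-dual sc mc
  where open Compliance BT _≤:_ (IsPreorder.refl isPreorder) B B-refl
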